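{- Let $n\geq 2$ and $1\leq j\leq n-1$ be integers, let $e_1,\ldots,e_n$ be the standard basis of $\mathbb R^n$, and define vectors $$c_i=\begin{cases} e_1+e_2+\cdots+e_j,& i=1, \\ e_1+e_2+\cdots+e_{j+1}-e_{i-1},&2\leq i\leq j+1, \\ e_{i-j+1}+e_{i-j+2}+\cdots+e_{i},& j+2\leq i\leq n.\end{cases}$$ Let $C$ be the $n\times n$ matrix whose columns are $c_1,c_2,\ldots,c_n$. Then $\det(C)=j$. -}

module Defs where

open import Data.Nat using (ℕ; zero; suc; _∸_; _≤ᵇ_; _≡ᵇ_)
open import Data.Bool using (Bool; true; false; if_then_else_; _∧_; not)
open import Data.Fin using (Fin; zero; suc; toℕ; punchIn)
open import Data.Integer using (ℤ; +_; -_; _+_; _*_)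

-- Square matrices over ℤ, indexed as M row column.
Matrix : ℕ → Set
Matrix n = Fin n → Fin n → ℤ

sumFin : ∀ {n} → (Fin n → ℤ) → ℤ
sumFin {zero}  f = + 0
sumFin {suc n} f = f zero + sumFin (λ k → f (suc k))

sgn : ℕ → ℤ
sgn zero    = + 1
sgn (suc k) = - sgn k

det : ∀ n → Matrix n → ℤ
det zero    M = + 1
det (suc n) M =
  sumFin (λ k → sgn (toℕ k) * M zero k * det n (λ i l → M (suc i) (punchIn k l)))

ind : Bool → ℤ
ind true  = + 1
ind false = + 0

-- r-th coordinate (1-based) of the vector c_i (1-based i), for parameter j:
--   c_1 = e_1 + ... + e_j
--   c_i = e_1 + ... + e_{j+1} - e_{i-1}          (2 ≤ i ≤ j+1)
--   c_i = e_{i-j+1} + ... + e_i                   (j+2 ≤ i ≤ n)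
cCoord : (j i r : ℕ) → ℤ
cCoord j i r =
  if i ≤ᵇ 1 then ind (r ≤ᵇ j)
  else if i ≤ᵇ suc j then ind ((r ≤ᵇ suc j) ∧ not (r ≡ᵇ (i ∸ 1)))
  else ind ((suc (i ∸ j) ≤ᵇ r) ∧ (r ≤ᵇ i))

Cmat : (n j : ℕ) → Matrix n
Cmat n j r i = cCoord j (suc (toℕ i)) (suc (toℕ r))

-- For r > j the r-th row of C (counting from 0) vanishes left of the diagonal and
-- has a 1 on it, so expanding along the last row repeatedly shows that det C is the
-- determinant of the leading (j+1)×(j+1) block.  That block is J − P, with J the
-- all-ones matrix and P the permutation matrix of a (j+1)-cycle.  Subtracting from
-- each of the columns 1, …, j−1 its right neighbour, from left to right, makes its last
-- row a unit vector again; what is left is the j×j matrix K whose first column is all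
-- ones and whose other columns are e_c − e_{c−1}.  Expanding K along its first row
-- gives det K_{m+1} = det (I − shift) + det K_m = 1 + det K_m, hence det K_j = j.
-- The column operations rest on additivity of det in one column and its vanishing on
-- two equal adjacent columns, both proved by induction through the first-row expansion.

module Submission where

open import Defs
open import Data.Nat using (ℕ; zero; suc; _≤_; _<_; _∸_; z≤n; s≤s; _≡ᵇ_; _<ᵇ_)
import Data.Nat as ℕ
import Data.Nat.Properties as ℕ
open import Data.Bool using (true; false; if_then_else_; not)
open import Data.Bool.Properties using (∧-zeroʳ)
open import Data.Fin using (Fin; zero; suc; toℕ; punchIn; punchOut; inject₁; fromℕ; fromℕ<; _≟_)
open import Data.Fin.Properties
  using (punchIn-injective; punchInᵢ≢i; punchIn-punchOut; toℕ-inject₁; toℕ-fromℕ; toℕ-fromℕ<; toℕ<n; toℕ-injective; suc-injective)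
open import Data.Integer using (ℤ; +_; -_; _+_; _*_; _-_)
open import Data.Integer.Properties using (+-identityˡ; +-identityʳ; +-assoc; *-zeroʳ; +-commutativeSemigroup)
open import Data.Integer.Tactic.RingSolver using (solve-∀)
open import Algebra.Properties.CommutativeSemigroup +-commutativeSemigroup using (interchange)
open import Data.Product using (Σ; _×_; _,_)
open import Data.Sum using (_⊎_; inj₁; inj₂)
open import Function using (_∘_)
open import Data.Empty using (⊥-elim)
open import Relation.Nullary using (yes; no)
open import Relation.Binary.PropositionalEquality
  using (_≡_; _≢_; refl; sym; trans; cong; cong₂; subst; module ≡-Reasoning)
open ≡-Reasoning

sumFin-cong : ∀ {n} {f g : Fin n → ℤ} → (∀ k → f k ≡ g k) → sumFin f ≡ sumFin g
sumFin-cong {zero}  f≗g = refl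
sumFin-cong {suc n} f≗g = cong₂ _+_ (f≗g zero) (sumFin-cong (f≗g ∘ suc))

sumFin-zeros : ∀ {n} {f : Fin n → ℤ} → (∀ k → f k ≡ + 0) → sumFin f ≡ + 0
sumFin-zeros {zero}  f≗0 = refl
sumFin-zeros {suc n} f≗0 = cong₂ _+_ (f≗0 zero) (sumFin-zeros (f≗0 ∘ suc))

sumFin-+ : ∀ {n} (f g : Fin n → ℤ) → sumFin (λ k → f k + g k) ≡ sumFin f + sumFin g
sumFin-+ {zero}  f g = refl
sumFin-+ {suc n} f g = trans (cong (_+_ (f zero + g zero)) (sumFin-+ (f ∘ suc) (g ∘ suc)))
                             (interchange (f zero) (g zero) _ _)

sumFin-init-last : ∀ {n} (f : Fin (suc n) → ℤ) → sumFin f ≡ sumFin (f ∘ inject₁) + f (fromℕ n)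
sumFin-init-last {zero}  f = trans (+-identityʳ (f zero)) (sym (+-identityˡ (f zero)))
sumFin-init-last {suc n} f = begin
  f zero + sumFin (f ∘ suc)                            ≡⟨ cong (_+_ (f zero)) (sumFin-init-last (f ∘ suc)) ⟩
  f zero + (sumFin (f ∘ suc ∘ inject₁) + f (fromℕ (suc n))) ≡⟨ sym (+-assoc (f zero) _ _) ⟩
  sumFin (f ∘ inject₁) + f (fromℕ (suc n))             ∎

sumFin-adjacent : ∀ {n} (f : Fin (suc n) → ℤ) (a : Fin n) →
                  (∀ k → k ≢ inject₁ a → k ≢ suc a → f k ≡ + 0) →
                  sumFin f ≡ f (inject₁ a) + f (suc a)
sumFin-adjacent {suc n} f zero    f≗0 =
  cong (_+_ (f zero)) (trans (cong (_+_ (f (suc zero))) (sumFin-zeros (λ k → f≗0 (suc (suc k)) (λ ()) (λ ()))))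
                          (+-identityʳ (f (suc zero))))
sumFin-adjacent {suc n} f (suc a) f≗0 =
  trans (cong₂ _+_ (f≗0 zero (λ ()) (λ ()))
                   (sumFin-adjacent (f ∘ suc) a (λ k k≢a k≢1+a → f≗0 (suc k) (k≢a ∘ suc-injective) (k≢1+a ∘ suc-injective))))
        (+-identityˡ _)

minor : ∀ {n} → Matrix (suc n) → Fin (suc n) → Matrix n
minor M k i l = M (suc i) (punchIn k l)

laplaceTerm : ∀ {n} → Matrix (suc n) → Fin (suc n) → ℤ
laplaceTerm {n} M k = sgn (toℕ k) * M zero k * det n (minor M k)

laplaceTerm-zeroEntry : ∀ {n} (M : Matrix (suc n)) k → M zero k ≡ + 0 → laplaceTerm M k ≡ + 0
laplaceTerm-zeroEntry M k Mk≡0 rewrite Mk≡0 | *-zeroʳ (sgn (toℕ k)) = refl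

laplaceTerm-zeroMinor : ∀ {n} (M : Matrix (suc n)) k → det n (minor M k) ≡ + 0 → laplaceTerm M k ≡ + 0
laplaceTerm-zeroMinor M k d≡0 rewrite d≡0 = *-zeroʳ (sgn (toℕ k) * M zero k)

det-cong : ∀ n {M N : Matrix n} → (∀ i l → M i l ≡ N i l) → det n M ≡ det n N
det-cong zero    M≗N = refl
det-cong (suc n) M≗N = sumFin-cong λ k →
  cong₂ (λ x d → sgn (toℕ k) * x * d) (M≗N zero k) (det-cong n (λ i l → M≗N (suc i) (punchIn k l)))

det-zeroRow : ∀ n (M : Matrix n) r → (∀ c → M r c ≡ + 0) → det n M ≡ + 0
det-zeroRow (suc n) M zero    row≗0 = sumFin-zeros λ k → laplaceTerm-zeroEntry M k (row≗0 k)
det-zeroRow (suc n) M (suc r) row≗0 = sumFin-zeros λ k →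
  laplaceTerm-zeroMinor M k (det-zeroRow n (minor M k) r (row≗0 ∘ punchIn k))

punchIn-inject₁ : ∀ {n} (k : Fin (suc n)) (l : Fin n) → punchIn (inject₁ k) (inject₁ l) ≡ inject₁ (punchIn k l)
punchIn-inject₁ zero    l       = refl
punchIn-inject₁ (suc k) zero    = refl
punchIn-inject₁ (suc k) (suc l) = cong suc (punchIn-inject₁ k l)

punchIn-inject₁-fromℕ : ∀ {n} (k : Fin (suc n)) → punchIn (inject₁ k) (fromℕ n) ≡ fromℕ (suc n)
punchIn-inject₁-fromℕ zero              = refl
punchIn-inject₁-fromℕ {suc n} (suc k) = cong suc (punchIn-inject₁-fromℕ k)

punchIn-fromℕ : ∀ {n} (l : Fin n) → punchIn (fromℕ n) l ≡ inject₁ l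
punchIn-fromℕ zero    = refl
punchIn-fromℕ (suc l) = cong suc (punchIn-fromℕ l)

det-lastRow : ∀ n (M : Matrix (suc n)) → M (fromℕ n) (fromℕ n) ≡ + 1 → (∀ l → M (fromℕ n) (inject₁ l) ≡ + 0) →
              det (suc n) M ≡ det n (λ i l → M (inject₁ i) (inject₁ l))
det-lastRow zero    M last≡1 _ rewrite last≡1 = refl
det-lastRow (suc n) M last≡1 last≗0 = begin
  sumFin (laplaceTerm M)                                          ≡⟨ sumFin-init-last (laplaceTerm M) ⟩
  sumFin (laplaceTerm M ∘ inject₁) + laplaceTerm M (fromℕ (suc n)) ≡⟨ cong₂ _+_ (sumFin-cong inner) outer ⟩
  sumFin (laplaceTerm M′) + + 0                                   ≡⟨ +-identityʳ _ ⟩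
  sumFin (laplaceTerm M′)                                         ∎
  where
  M′ : Matrix (suc n)
  M′ i l = M (inject₁ i) (inject₁ l)
  inner : ∀ k → laplaceTerm M (inject₁ k) ≡ laplaceTerm M′ k
  inner k = cong₂ (λ t d → sgn t * M zero (inject₁ k) * d) (toℕ-inject₁ k) (begin
    det (suc n) (minor M (inject₁ k))
      ≡⟨ det-lastRow n (minor M (inject₁ k))
           (trans (cong (M (fromℕ (suc n))) (punchIn-inject₁-fromℕ k)) last≡1)
           (λ l → trans (cong (M (fromℕ (suc n))) (punchIn-inject₁ k l)) (last≗0 (punchIn k l))) ⟩
    det n (λ i l → M (suc (inject₁ i)) (punchIn (inject₁ k) (inject₁ l)))
      ≡⟨ det-cong n (λ i l → cong (M (suc (inject₁ i))) (punchIn-inject₁ k l)) ⟩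
    det n (minor M′ k) ∎)
  outer : laplaceTerm M (fromℕ (suc n)) ≡ + 0
  outer = laplaceTerm-zeroMinor M (fromℕ (suc n)) (det-zeroRow (suc n) (minor M (fromℕ (suc n))) (fromℕ n)
            (λ l → trans (cong (M (fromℕ (suc n))) (punchIn-fromℕ l)) (last≗0 l)))

minor-cong-≢ : ∀ {n} {M N : Matrix (suc n)} (a : Fin (suc n)) →
                 (∀ i l → l ≢ a → M i l ≡ N i l) → ∀ i l → minor M a i l ≡ minor N a i l
minor-cong-≢ a M≗N i l = M≗N (suc i) (punchIn a l) (punchInᵢ≢i a l)

det-additive : ∀ n (M N P : Matrix n) (a : Fin n) →
               (∀ i l → l ≢ a → M i l ≡ N i l) → (∀ i l → l ≢ a → M i l ≡ P i l) →
               (∀ i → M i a ≡ N i a + P i a) → det n M ≡ det n N + det n P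
det-additive (suc n) M N P a M≗N M≗P Ma≗Na+Pa =
  trans (sumFin-cong term) (sumFin-+ (laplaceTerm N) (laplaceTerm P))
  where
  distribˡ : ∀ s x y d → s * (x + y) * d ≡ s * x * d + s * y * d
  distribˡ = solve-∀
  distribʳ : ∀ s x d e → s * x * (d + e) ≡ s * x * d + s * x * e
  distribʳ = solve-∀
  term : ∀ k → laplaceTerm M k ≡ laplaceTerm N k + laplaceTerm P k
  term k with k ≟ a
  ... | yes refl = begin
    sgn (toℕ k) * M zero k * det n (minor M k)
      ≡⟨ cong (λ x → sgn (toℕ k) * x * det n (minor M k)) (Ma≗Na+Pa zero) ⟩
    sgn (toℕ k) * (N zero k + P zero k) * det n (minor M k)
      ≡⟨ distribˡ (sgn (toℕ k)) (N zero k) (P zero k) _ ⟩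
    sgn (toℕ k) * N zero k * det n (minor M k) + sgn (toℕ k) * P zero k * det n (minor M k)
      ≡⟨ cong₂ (λ d e → sgn (toℕ k) * N zero k * d + sgn (toℕ k) * P zero k * e)
               (det-cong n (minor-cong-≢ k M≗N)) (det-cong n (minor-cong-≢ k M≗P)) ⟩
    laplaceTerm N k + laplaceTerm P k ∎
  ... | no k≢a = begin
    sgn (toℕ k) * M zero k * det n (minor M k)
      ≡⟨ cong (_*_ (sgn (toℕ k) * M zero k)) minorAdditive ⟩
    sgn (toℕ k) * M zero k * (det n (minor N k) + det n (minor P k))
      ≡⟨ distribʳ (sgn (toℕ k)) (M zero k) _ _ ⟩
    sgn (toℕ k) * M zero k * det n (minor N k) + sgn (toℕ k) * M zero k * det n (minor P k)
      ≡⟨ cong₂ (λ x y → sgn (toℕ k) * x * det n (minor N k) + sgn (toℕ k) * y * det n (minor P k))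
               (M≗N zero k k≢a) (M≗P zero k k≢a) ⟩
    laplaceTerm N k + laplaceTerm P k ∎
    where
    a′ : Fin n
    a′ = punchOut k≢a
    punchIn-≢ : ∀ l → l ≢ a′ → punchIn k l ≢ a
    punchIn-≢ l l≢a′ eq = l≢a′ (punchIn-injective k l a′ (trans eq (sym (punchIn-punchOut k≢a))))
    minorAdditive : det n (minor M k) ≡ det n (minor N k) + det n (minor P k)
    minorAdditive = det-additive n (minor M k) (minor N k) (minor P k) a′
      (λ i l l≢a′ → M≗N (suc i) (punchIn k l) (punchIn-≢ l l≢a′))
      (λ i l l≢a′ → M≗P (suc i) (punchIn k l) (punchIn-≢ l l≢a′))
      (λ i → subst (λ c → M (suc i) c ≡ N (suc i) c + P (suc i) c) (sym (punchIn-punchOut k≢a)) (Ma≗Na+Pa (suc i)))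

punchIn-adjacent : ∀ {n} (k : Fin (suc (suc n))) (a : Fin (suc n)) → k ≢ inject₁ a → k ≢ suc a →
                   Σ (Fin n) λ a′ → punchIn k (inject₁ a′) ≡ inject₁ a × punchIn k (suc a′) ≡ suc a
punchIn-adjacent zero          zero    k≢a _     = ⊥-elim (k≢a refl)
punchIn-adjacent zero          (suc a) _   _     = a , refl , refl
punchIn-adjacent (suc zero)    zero    _   k≢1+a = ⊥-elim (k≢1+a refl)
punchIn-adjacent {suc n} (suc (suc k)) zero _ _  = zero , refl , refl
punchIn-adjacent {suc n} (suc k) (suc a) k≢a k≢1+a
  with punchIn-adjacent k a (k≢a ∘ cong suc) (k≢1+a ∘ cong suc)
... | a′ , p , q = suc a′ , cong suc p , cong suc q

punchIn-inject₁-suc : ∀ {n} (a l : Fin n) →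
                      punchIn (inject₁ a) l ≡ punchIn (suc a) l ⊎
                      (punchIn (inject₁ a) l ≡ suc a × punchIn (suc a) l ≡ inject₁ a)
punchIn-inject₁-suc zero    zero    = inj₂ (refl , refl)
punchIn-inject₁-suc zero    (suc l) = inj₁ refl
punchIn-inject₁-suc (suc a) zero    = inj₁ refl
punchIn-inject₁-suc (suc a) (suc l) with punchIn-inject₁-suc a l
... | inj₁ eq         = inj₁ (cong suc eq)
... | inj₂ (eq₁ , eq₂) = inj₂ (cong suc eq₁ , cong suc eq₂)

det-equalAdjacentColumns : ∀ n (M : Matrix (suc n)) (a : Fin n) →
                           (∀ i → M i (inject₁ a) ≡ M i (suc a)) → det (suc n) M ≡ + 0
det-equalAdjacentColumns (suc n) M a cols≡ = begin
  sumFin (laplaceTerm M)                            ≡⟨ sumFin-adjacent (laplaceTerm M) a others≡0 ⟩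
  laplaceTerm M (inject₁ a) + laplaceTerm M (suc a) ≡⟨ cong (λ t → t + laplaceTerm M (suc a)) left≡ ⟩
  s * x * d + (- s) * x * d                         ≡⟨ cancel s x d ⟩
  + 0                                               ∎
  where
  s x d : ℤ
  s = sgn (toℕ a)
  x = M zero (suc a)
  d = det (suc n) (minor M (suc a))
  cancel : ∀ s x d → s * x * d + (- s) * x * d ≡ + 0
  cancel = solve-∀
  minors≡ : ∀ i l → minor M (inject₁ a) i l ≡ minor M (suc a) i l
  minors≡ i l with punchIn-inject₁-suc a l
  ... | inj₁ eq         = cong (M (suc i)) eq
  ... | inj₂ (eq₁ , eq₂) = trans (cong (M (suc i)) eq₁) (trans (sym (cols≡ (suc i))) (cong (M (suc i)) (sym eq₂)))
  left≡ : laplaceTerm M (inject₁ a) ≡ s * x * d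
  left≡ = trans (cong₂ (λ t y → sgn t * y * det (suc n) (minor M (inject₁ a))) (toℕ-inject₁ a) (cols≡ zero))
                (cong (_*_ (s * x)) (det-cong (suc n) minors≡))
  others≡0 : ∀ k → k ≢ inject₁ a → k ≢ suc a → laplaceTerm M k ≡ + 0
  others≡0 k k≢a k≢1+a with punchIn-adjacent k a k≢a k≢1+a
  ... | a′ , p , q = laplaceTerm-zeroMinor M k (det-equalAdjacentColumns n (minor M k) a′
        (λ i → trans (cong (M (suc i)) p) (trans (cols≡ (suc i)) (cong (M (suc i)) (sym q)))))

-- Entries given as a function on ℕ × ℕ, so that every leading submatrix of
-- toMatrix n f is toMatrix m f for the same f.
toMatrix : ∀ n → (ℕ → ℕ → ℤ) → Matrix n
toMatrix n f i l = f (toℕ i) (toℕ l)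

det-cong-toMatrix : ∀ n (f g : ℕ → ℕ → ℤ) → (∀ r c → r < n → c < n → f r c ≡ g r c) →
                    det n (toMatrix n f) ≡ det n (toMatrix n g)
det-cong-toMatrix n f g f≗g = det-cong n λ i l → f≗g (toℕ i) (toℕ l) (toℕ<n i) (toℕ<n l)

det-lastRow-toMatrix : ∀ n (f : ℕ → ℕ → ℤ) → f n n ≡ + 1 → (∀ c → c < n → f n c ≡ + 0) →
                       det (suc n) (toMatrix (suc n) f) ≡ det n (toMatrix n f)
det-lastRow-toMatrix n f fnn≡1 fnc≡0 = begin
  det (suc n) (toMatrix (suc n) f)
    ≡⟨ det-lastRow n (toMatrix (suc n) f) (trans (cong₂ f (toℕ-fromℕ n) (toℕ-fromℕ n)) fnn≡1)
         (λ l → trans (cong₂ f (toℕ-fromℕ n) (toℕ-inject₁ l)) (fnc≡0 (toℕ l) (toℕ<n l))) ⟩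
  det n (λ i l → f (toℕ (inject₁ i)) (toℕ (inject₁ l)))
    ≡⟨ det-cong n (λ i l → cong₂ f (toℕ-inject₁ i) (toℕ-inject₁ l)) ⟩
  det n (toMatrix n f) ∎

det-dropUnitRows : ∀ m d (f : ℕ → ℕ → ℤ) → (∀ r → m ≤ r → f r r ≡ + 1) → (∀ r c → m ≤ r → c < r → f r c ≡ + 0) →
                   det (d ℕ.+ m) (toMatrix (d ℕ.+ m) f) ≡ det m (toMatrix m f)
det-dropUnitRows m zero    f diag≡1 below≡0 = refl
det-dropUnitRows m (suc d) f diag≡1 below≡0 =
  trans (det-lastRow-toMatrix (d ℕ.+ m) f (diag≡1 _ m≤d+m) (λ c → below≡0 _ c m≤d+m))
        (det-dropUnitRows m d f diag≡1 below≡0)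
  where
  m≤d+m : m ≤ d ℕ.+ m
  m≤d+m = ℕ.m≤n+m m d

det-unitUpperTriangular : ∀ n (f : ℕ → ℕ → ℤ) → (∀ r → f r r ≡ + 1) → (∀ r c → c < r → f r c ≡ + 0) →
                          det n (toMatrix n f) ≡ + 1
det-unitUpperTriangular n f diag≡1 below≡0 =
  subst (λ m → det m (toMatrix m f) ≡ + 1) (ℕ.+-identityʳ n)
        (det-dropUnitRows 0 n f (λ r _ → diag≡1 r) (λ r c _ → below≡0 r c))

≡ᵇ-refl : ∀ n → (n ≡ᵇ n) ≡ true
≡ᵇ-refl zero    = refl
≡ᵇ-refl (suc n) = ≡ᵇ-refl n

≢⇒≡ᵇ-false : ∀ {m n} → m ≢ n → (m ≡ᵇ n) ≡ false
≢⇒≡ᵇ-false {zero}  {zero}  m≢n = ⊥-elim (m≢n refl)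
≢⇒≡ᵇ-false {zero}  {suc n} _   = refl
≢⇒≡ᵇ-false {suc m} {zero}  _   = refl
≢⇒≡ᵇ-false {suc m} {suc n} m≢n = ≢⇒≡ᵇ-false (m≢n ∘ cong suc)

updateColumn : ℕ → (ℕ → ℤ) → (ℕ → ℕ → ℤ) → ℕ → ℕ → ℤ
updateColumn a v f r c = if c ≡ᵇ a then v r else f r c

updateColumn-same : ∀ a v f r → updateColumn a v f r a ≡ v r
updateColumn-same a v f r rewrite ≡ᵇ-refl a = refl

updateColumn-other : ∀ a v f r {c} → c ≢ a → updateColumn a v f r c ≡ f r c
updateColumn-other a v f r c≢a rewrite ≢⇒≡ᵇ-false c≢a = refl

subtractNextColumn : ℕ → (ℕ → ℕ → ℤ) → ℕ → ℕ → ℤ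
subtractNextColumn a f = updateColumn a (λ r → f r a - f r (suc a)) f

subtractNextColumn-same : ∀ a f r → subtractNextColumn a f r a ≡ f r a - f r (suc a)
subtractNextColumn-same a f = updateColumn-same a _ f

subtractNextColumn-other : ∀ a f r {c} → c ≢ a → subtractNextColumn a f r c ≡ f r c
subtractNextColumn-other a f = updateColumn-other a _ f

det-subtractNextColumn : ∀ n (f : ℕ → ℕ → ℤ) a → a < n →
                         det (suc n) (toMatrix (suc n) (subtractNextColumn a f)) ≡ det (suc n) (toMatrix (suc n) f)
det-subtractNextColumn n f a a<n = sym (begin
  detℕ f                                        ≡⟨ split ⟩
  detℕ (subtractNextColumn a f) + detℕ copy     ≡⟨ cong (_+_ (detℕ (subtractNextColumn a f))) copy≡0 ⟩
  detℕ (subtractNextColumn a f) + + 0           ≡⟨ +-identityʳ _ ⟩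
  detℕ (subtractNextColumn a f)                 ∎)
  where
  detℕ : (ℕ → ℕ → ℤ) → ℤ
  detℕ g = det (suc n) (toMatrix (suc n) g)
  â : Fin n
  â = fromℕ< a<n
  toℕ-â : toℕ (inject₁ â) ≡ a
  toℕ-â = trans (toℕ-inject₁ â) (toℕ-fromℕ< a<n)
  nextColumn : ℕ → ℤ
  nextColumn r = f r (suc a)
  copy : ℕ → ℕ → ℤ
  copy = updateColumn a nextColumn f
  off-â : ∀ (l : Fin (suc n)) → l ≢ inject₁ â → toℕ l ≢ a
  off-â l l≢â eq = l≢â (toℕ-injective (trans eq (sym toℕ-â)))
  minus-plus : ∀ x y → x ≡ x - y + y
  minus-plus = solve-∀
  split : detℕ f ≡ detℕ (subtractNextColumn a f) + detℕ copy
  split = det-additive (suc n) _ _ _ (inject₁ â)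
    (λ i l l≢â → sym (subtractNextColumn-other a f (toℕ i) (off-â l l≢â)))
    (λ i l l≢â → sym (updateColumn-other a nextColumn f (toℕ i) (off-â l l≢â)))
    λ i → subst (λ c → f (toℕ i) c ≡ subtractNextColumn a f (toℕ i) c + copy (toℕ i) c) (sym toℕ-â) (begin
      f (toℕ i) a                                            ≡⟨ minus-plus (f (toℕ i) a) (f (toℕ i) (suc a)) ⟩
      f (toℕ i) a - f (toℕ i) (suc a) + f (toℕ i) (suc a)    ≡⟨ sym (cong₂ _+_ (subtractNextColumn-same a f (toℕ i))
                                                                               (updateColumn-same a nextColumn f (toℕ i))) ⟩
      subtractNextColumn a f (toℕ i) a + copy (toℕ i) a      ∎)
  copy≡0 : detℕ copy ≡ + 0
  copy≡0 = det-equalAdjacentColumns n (toMatrix (suc n) copy) â λ i → begin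
    copy (toℕ i) (toℕ (inject₁ â)) ≡⟨ cong (copy (toℕ i)) toℕ-â ⟩
    copy (toℕ i) a                 ≡⟨ updateColumn-same a nextColumn f (toℕ i) ⟩
    f (toℕ i) (suc a)              ≡⟨ sym (updateColumn-other a nextColumn f (toℕ i) ℕ.1+n≢n) ⟩
    copy (toℕ i) (suc a)           ≡⟨ cong (copy (toℕ i) ∘ suc) (sym (toℕ-fromℕ< a<n)) ⟩
    copy (toℕ i) (toℕ (suc â))     ∎

differenceColumns : (s t : ℕ) → (ℕ → ℕ → ℤ) → ℕ → ℕ → ℤ
differenceColumns s zero    f = f
differenceColumns s (suc t) f = subtractNextColumn (s ℕ.+ t) (differenceColumns s t f)

det-differenceColumns : ∀ n s t (f : ℕ → ℕ → ℤ) → s ℕ.+ t ≤ n →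
                        det (suc n) (toMatrix (suc n) (differenceColumns s t f)) ≡ det (suc n) (toMatrix (suc n) f)
det-differenceColumns n s zero    f _      = refl
det-differenceColumns n s (suc t) f s+t<n′ =
  trans (det-subtractNextColumn n (differenceColumns s t f) (s ℕ.+ t) s+t<n)
        (det-differenceColumns n s t f (ℕ.<⇒≤ s+t<n))
  where
  s+t<n : s ℕ.+ t < n
  s+t<n = subst (_≤ n) (ℕ.+-suc s t) s+t<n′

differenceColumns-outside : ∀ s t (f : ℕ → ℕ → ℤ) r c → c < s ⊎ s ℕ.+ t ≤ c → differenceColumns s t f r c ≡ f r c
differenceColumns-outside s zero    f r c _ = refl
differenceColumns-outside s (suc t) f r c (inj₁ c<s) =
  trans (subtractNextColumn-other (s ℕ.+ t) (differenceColumns s t f) r (ℕ.<⇒≢ (ℕ.<-≤-trans c<s (ℕ.m≤m+n s t))))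
        (differenceColumns-outside s t f r c (inj₁ c<s))
differenceColumns-outside s (suc t) f r c (inj₂ s+t<c′) =
  trans (subtractNextColumn-other (s ℕ.+ t) (differenceColumns s t f) r (ℕ.>⇒≢ s+t<c))
        (differenceColumns-outside s t f r c (inj₂ (ℕ.<⇒≤ s+t<c)))
  where
  s+t<c : s ℕ.+ t < c
  s+t<c = subst (_≤ c) (ℕ.+-suc s t) s+t<c′

differenceColumns-inside : ∀ s t (f : ℕ → ℕ → ℤ) r c → s ≤ c → c < s ℕ.+ t →
                           differenceColumns s t f r c ≡ f r c - f r (suc c)
differenceColumns-inside s zero    f r c s≤c c<s+0 =
  ⊥-elim (ℕ.<⇒≱ (subst (c <_) (ℕ.+-identityʳ s) c<s+0) s≤c)
differenceColumns-inside s (suc t) f r c s≤c c<s+t′ with c ℕ.≟ s ℕ.+ t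
... | yes refl = trans (subtractNextColumn-same (s ℕ.+ t) (differenceColumns s t f) r)
                       (cong₂ _-_ (differenceColumns-outside s t f r c (inj₂ ℕ.≤-refl))
                                  (differenceColumns-outside s t f r (suc c) (inj₂ (ℕ.n≤1+n c))))
... | no c≢s+t = trans (subtractNextColumn-other (s ℕ.+ t) (differenceColumns s t f) r c≢s+t)
                       (differenceColumns-inside s t f r c s≤c
                          (ℕ.≤∧≢⇒< (ℕ.s≤s⁻¹ (subst (c <_) (ℕ.+-suc s t) c<s+t′)) c≢s+t))

notEq : ℕ → ℕ → ℤ
notEq m n = ind (not (m ≡ᵇ n))

notEq-refl : ∀ n → notEq n n ≡ + 0
notEq-refl n rewrite ≡ᵇ-refl n = refl

notEq-≢ : ∀ {m n} → m ≢ n → notEq m n ≡ + 1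
notEq-≢ m≢n rewrite ≢⇒≡ᵇ-false m≢n = refl

idMinusShift : ℕ → ℕ → ℤ
idMinusShift r c = notEq (suc r) c - notEq r c

det-idMinusShift : ∀ n → det n (toMatrix n idMinusShift) ≡ + 1
det-idMinusShift n = det-unitUpperTriangular n idMinusShift diag below
  where
  diag : ∀ r → idMinusShift r r ≡ + 1
  diag r rewrite notEq-≢ (ℕ.1+n≢n {r}) | notEq-refl r = refl
  below : ∀ r c → c < r → idMinusShift r c ≡ + 0
  below r c c<r rewrite notEq-≢ (ℕ.<⇒≢ (ℕ.m<n⇒m<1+n c<r) ∘ sym) | notEq-≢ (ℕ.<⇒≢ c<r ∘ sym) = refl

onesAndDifferences : ℕ → ℕ → ℤ
onesAndDifferences r zero    = + 1
onesAndDifferences r (suc c) = notEq r c - notEq r (suc c)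

det-onesAndDifferences : ∀ q → det (suc q) (toMatrix (suc q) onesAndDifferences) ≡ + suc q
det-onesAndDifferences zero    = refl
det-onesAndDifferences (suc q) = begin
  det (suc (suc q)) K
    ≡⟨⟩
  laplaceTerm K zero + (laplaceTerm K (suc zero) + sumFin (λ k → laplaceTerm K (suc (suc k))))
    ≡⟨ cong₂ _+_ (cong (_*_ (+ 1 * + 1)) (det-idMinusShift (suc q)))
                 (cong₂ _+_ (cong (_*_ (- + 1 * (+ 0 - + 1))) (trans minor₁ (det-onesAndDifferences q)))
                            (sumFin-zeros λ k → laplaceTerm-zeroEntry K (suc (suc k)) refl)) ⟩
  + 1 * + 1 * + 1 + (- + 1 * (+ 0 - + 1) * + suc q + + 0)
    ≡⟨ arith (+ suc q) ⟩
  + 1 + + suc q ∎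
  where
  -- The first row of K is (1, −1, 0, …, 0); its two relevant minors are I − shift and K itself.
  K : Matrix (suc (suc q))
  K = toMatrix (suc (suc q)) onesAndDifferences
  minor₁ : det (suc q) (minor K (suc zero)) ≡ det (suc q) (toMatrix (suc q) onesAndDifferences)
  minor₁ = det-cong (suc q) minor₁≗
    where
    minor₁≗ : ∀ i l → minor K (suc zero) i l ≡ toMatrix (suc q) onesAndDifferences i l
    minor₁≗ i zero    = refl
    minor₁≗ i (suc l) = refl
  arith : ∀ x → + 1 * + 1 * + 1 + (- + 1 * (+ 0 - + 1) * x + + 0) ≡ + 1 + x
  arith = solve-∀

onesMinusCycle : ℕ → ℕ → ℕ → ℤ
onesMinusCycle j r zero    = notEq r j
onesMinusCycle j r (suc c) = notEq r c

det-onesMinusCycle : ∀ j → det (suc j) (toMatrix (suc j) (onesMinusCycle j)) ≡ + j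
det-onesMinusCycle zero    = refl
det-onesMinusCycle (suc q) = begin
  det (suc (suc q)) (toMatrix (suc (suc q)) B) ≡⟨ sym (det-differenceColumns (suc q) 1 q B ℕ.≤-refl) ⟩
  det (suc (suc q)) (toMatrix (suc (suc q)) D) ≡⟨ det-lastRow-toMatrix (suc q) D lastDiag lastBelow ⟩
  det (suc q) (toMatrix (suc q) D)             ≡⟨ det-cong-toMatrix (suc q) D onesAndDifferences leading ⟩
  det (suc q) (toMatrix (suc q) onesAndDifferences) ≡⟨ det-onesAndDifferences q ⟩
  + suc q                                      ∎
  where
  B D : ℕ → ℕ → ℤ
  B = onesMinusCycle (suc q)
  D = differenceColumns 1 q B
  lastDiag : D (suc q) (suc q) ≡ + 1
  lastDiag = trans (differenceColumns-outside 1 q B (suc q) (suc q) (inj₂ ℕ.≤-refl)) (notEq-≢ (ℕ.1+n≢n {q}))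
  lastBelow : ∀ c → c < suc q → D (suc q) c ≡ + 0
  lastBelow zero    _ = trans (differenceColumns-outside 1 q B (suc q) zero (inj₁ (s≤s z≤n))) (notEq-refl (suc q))
  lastBelow (suc c) (s≤s c<q)
    rewrite differenceColumns-inside 1 q B (suc q) (suc c) (s≤s z≤n) (s≤s c<q)
          | notEq-≢ (ℕ.<⇒≢ (ℕ.m<n⇒m<1+n c<q) ∘ sym) | notEq-≢ (ℕ.<⇒≢ (s≤s c<q) ∘ sym) = refl
  leading : ∀ r c → r < suc q → c < suc q → D r c ≡ onesAndDifferences r c
  leading r zero    r<1+q _ = trans (differenceColumns-outside 1 q B r zero (inj₁ (s≤s z≤n))) (notEq-≢ (ℕ.<⇒≢ r<1+q))
  leading r (suc c) _ (s≤s c<q) = differenceColumns-inside 1 q B r (suc c) (s≤s z≤n) (s≤s c<q)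

cEntry : ℕ → ℕ → ℕ → ℤ
cEntry j r c = cCoord j (suc c) (suc r)

<ᵇ-true : ∀ {m n} → m < n → (m <ᵇ n) ≡ true
<ᵇ-true {zero}  {suc n} _         = refl
<ᵇ-true {suc m} {suc n} (s≤s m<n) = <ᵇ-true m<n

<ᵇ-false : ∀ {m n} → n ≤ m → (m <ᵇ n) ≡ false
<ᵇ-false {m}     {zero}  _         = refl
<ᵇ-false {suc m} {suc n} (s≤s n≤m) = <ᵇ-false n≤m

<ᵇ≡not≡ᵇ : ∀ {m n} → m ≤ n → (m <ᵇ n) ≡ not (m ≡ᵇ n)
<ᵇ≡not≡ᵇ {zero}  {zero}  _         = refl
<ᵇ≡not≡ᵇ {zero}  {suc n} _         = refl
<ᵇ≡not≡ᵇ {suc m} {suc n} (s≤s m≤n) = <ᵇ≡not≡ᵇ m≤n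

cEntry-leading : ∀ j r c → r ≤ j → c ≤ j → cEntry j r c ≡ onesMinusCycle j r c
cEntry-leading j r zero    r≤j _ = cong ind (<ᵇ≡not≡ᵇ r≤j)
cEntry-leading j r (suc c) r≤j c<j rewrite <ᵇ-true c<j | <ᵇ-true (s≤s r≤j) = refl

cEntry-diag : ∀ j r → 1 ≤ j → j < r → cEntry j r r ≡ + 1
cEntry-diag (suc j) (suc r) _ (s≤s j<r)
  rewrite <ᵇ-false j<r | <ᵇ-true (s≤s (ℕ.m∸n≤m (suc r) j)) | <ᵇ-true (ℕ.n<1+n r) = refl

cEntry-below : ∀ j r c → j < r → c < r → cEntry j r c ≡ + 0
cEntry-below j r zero    j<r _ rewrite <ᵇ-false (ℕ.<⇒≤ j<r) = refl
cEntry-below j r (suc c) j<r c<r with c ℕ.<? j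
... | yes c<j rewrite <ᵇ-true c<j | <ᵇ-false j<r = refl
... | no  c≮j rewrite <ᵇ-false (ℕ.≮⇒≥ c≮j) | <ᵇ-false c<r = cong ind (∧-zeroʳ _)

lemma4p1 : (n j : ℕ) → 2 ≤ n → 1 ≤ j → j ≤ n ∸ 1 → det n (Cmat n j) ≡ + j
lemma4p1 (suc n) j _ 1≤j j≤n = subst (λ m → det m (Cmat m j) ≡ + j) (ℕ.m∸n+n≡m (s≤s j≤n)) (begin
  det (d ℕ.+ suc j) (toMatrix (d ℕ.+ suc j) (cEntry j))
    ≡⟨ det-dropUnitRows (suc j) d (cEntry j) (λ r → cEntry-diag j r 1≤j) (cEntry-below j) ⟩
  det (suc j) (toMatrix (suc j) (cEntry j))
    ≡⟨ det-cong-toMatrix (suc j) _ _ (λ r c r<1+j c<1+j → cEntry-leading j r c (ℕ.s≤s⁻¹ r<1+j) (ℕ.s≤s⁻¹ c<1+j)) ⟩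
  det (suc j) (toMatrix (suc j) (onesMinusCycle j))
    ≡⟨ det-onesMinusCycle j ⟩
  + j ∎)
  where
  d : ℕ
  d = suc n ∸ suc j
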